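{- Let $E$ be an $n$-dimensional Euclidean space, let $\mathcal{B}=(e_1,\dots,e_n)$ and $\mathcal{B}'=(e'_1,\dots,e'_n)$ be two bases of $E$ consisting of unit vectors, with dual bases $(e_i^*)$ and $({e'_i}^*)$, and let $\lambda_1,\dots,\lambda_n,\lambda'_1,\dots,\lambda'_n$ be real numbers. Then the following conditions are equivalent: (1) $\sum_{i=1}^n\lambda_i\,p_{e_i}=\sum_{i=1}^n\lambda'_i\,p_{e'_i}$; (2) for all $j$, $\lambda_je_j=\sum_{i=1}^n\lambda'_i\,(e'_i\cdot e_j^*)\,e'_i$; (3) for all $k$, $\lambda'_ke'_k=\sum_{i=1}^n\lambda_i\,(e_i\cdot {e'_k}^*)\,e_i$; (4) for all $j,k$, $\lambda_j\,(e_j\cdot{e'_k}^*)=\lambda'_k\,(e'_k\cdot e_j^*)$.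
   Context: $p_x$ is the orthogonal projection onto $\mathbb{R}x$. The dual basis $(e_i^*)$ of $(e_i)$ is defined by $e_i\cdot e_j^*=\delta_{ij}$. -}

module Defs where

open import Level using (0ℓ)
open import Data.Nat using (ℕ; zero; suc)
open import Data.Fin using (Fin; zero; suc)
open import Data.Product using (Σ; ∃; _×_)
open import Relation.Nullary using (¬_)
open import Relation.Binary.PropositionalEquality using (_≡_)
open import Relation.Binary.Structures using (IsTotalOrder)
open import Algebra.Structures using (IsCommutativeRing)

-- The real numbers, axiomatised as a complete ordered field
-- (any model is isomorphic to ℝ).
record RealField : Set₁ where
  infixl 7 _*_
  infixl 6 _+_
  infix  4 _≈_ _≤_
  field
    Carrier : Set
    _≈_     : Carrier → Carrier → Set
    _+_     : Carrier → Carrier → Carrier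
    _*_     : Carrier → Carrier → Carrier
    -_      : Carrier → Carrier
    0#      : Carrier
    1#      : Carrier
    isCommutativeRing : IsCommutativeRing _≈_ _+_ _*_ -_ 0# 1#
    _≤_     : Carrier → Carrier → Set
    isTotalOrder : IsTotalOrder _≈_ _≤_
    0≉1     : ¬ (0# ≈ 1#)
    inverse : ∀ x → ¬ (x ≈ 0#) → Σ Carrier (λ y → x * y ≈ 1#)
    +-mono-≤ : ∀ {x y} z → x ≤ y → x + z ≤ y + z
    *-nonneg : ∀ {x y} → 0# ≤ x → 0# ≤ y → 0# ≤ x * y
    complete : (P : Carrier → Set) → Σ Carrier P →
               Σ Carrier (λ b → ∀ x → P x → x ≤ b) →
               Σ Carrier (λ s → (∀ x → P x → x ≤ s) ×
                                (∀ b → (∀ x → P x → x ≤ b) → s ≤ b))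

module Euclid (R : RealField) where
  open RealField R

  ∑ : ∀ {n} → (Fin n → Carrier) → Carrier
  ∑ {zero}  f = 0#
  ∑ {suc n} f = f zero + ∑ (λ i → f (suc i))

  -- the n-dimensional Euclidean space ℝⁿ with the standard inner product
  Vec : ℕ → Set
  Vec n = Fin n → Carrier

  infix 4 _≈ᵥ_
  _≈ᵥ_ : ∀ {n} → Vec n → Vec n → Set
  u ≈ᵥ v = ∀ a → u a ≈ v a

  infixl 7 _•_
  _•_ : ∀ {n} → Carrier → Vec n → Vec n
  (c • v) a = c * v a

  ∑ᵥ : ∀ {n m} → (Fin m → Vec n) → Vec n
  ∑ᵥ f a = ∑ (λ i → f i a)

  infix 8 _·_
  _·_ : ∀ {n} → Vec n → Vec n → Carrier
  u · v = ∑ (λ a → u a * v a)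

  IsUnit : ∀ {n} → Vec n → Set
  IsUnit x = x · x ≈ 1#

  -- orthogonal projection onto ℝx, for a unit vector x: p_x(y) = (x·y) x
  p : ∀ {n} → Vec n → Vec n → Vec n
  p x y = (x · y) • x

  δ : ∀ {n} → Fin n → Fin n → Carrier
  δ zero    zero    = 1#
  δ zero    (suc j) = 0#
  δ (suc i) zero    = 0#
  δ (suc i) (suc j) = δ i j

  LinIndep : ∀ {n} → (Fin n → Vec n) → Set
  LinIndep e = ∀ (c : Fin _ → Carrier) → ∑ᵥ (λ i → c i • e i) ≈ᵥ (λ _ → 0#) → ∀ i → c i ≈ 0#

  Spans : ∀ {n} → (Fin n → Vec n) → Set
  Spans e = ∀ v → Σ (Fin _ → Carrier) (λ c → v ≈ᵥ ∑ᵥ (λ i → c i • e i))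

  IsBasis : ∀ {n} → (Fin n → Vec n) → Set
  IsBasis e = LinIndep e × Spans e

  IsDualBasis : ∀ {n} → (Fin n → Vec n) → (Fin n → Vec n) → Set
  IsDualBasis e e* = ∀ i j → e i · e* j ≈ δ i j

  module _ {n : ℕ} (e e′ e* e′* : Fin n → Vec n) (λ₁ λ′ : Fin n → Carrier) where
    Cond1 : Set
    Cond1 = ∀ y → ∑ᵥ (λ i → λ₁ i • p (e i) y) ≈ᵥ ∑ᵥ (λ i → λ′ i • p (e′ i) y)
    Cond2 : Set
    Cond2 = ∀ j → λ₁ j • e j ≈ᵥ ∑ᵥ (λ i → (λ′ i * (e′ i · e* j)) • e′ i)
    Cond3 : Set
    Cond3 = ∀ k → λ′ k • e′ k ≈ᵥ ∑ᵥ (λ i → (λ₁ i * (e i · e′* k)) • e i)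
    Cond4 : Set
    Cond4 = ∀ j k → λ₁ j * (e j · e′* k) ≈ λ′ k * (e′ k · e* j)

-- The operator P y = ∑ μ_i (f_i·y) f_i is linear in y, and since e_i·e*_j = δ_ij,
-- every y satisfies f·y = ∑_j (e_j·y)(f·e*_j).  Hence such an operator is
-- determined by its values at the e*_j, while Σ λ_i p_{e_i} sends e*_j to λ_j e_j:
-- this is (1) ⇔ (2), and exchanging the two bases turns (2) into (3).  A vector is
-- determined by its pairings with e′*, and pairing both sides of (2) with e′*_k
-- gives the two sides of (4).
module Submission where

open import Defs
open import Data.Nat using (ℕ; zero; suc)
open import Data.Fin using (Fin; zero; suc)
open import Data.Product using (_×_; _,_; proj₁; proj₂)
open import Function.Bundles using (_⇔_; mk⇔; Equivalence)
open import Function.Construct.Composition using (_⇔-∘_)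
open import Algebra.Bundles using (CommutativeRing)
open import Algebra.Structures using (IsCommutativeRing)
open import Relation.Binary.PropositionalEquality as ≡ using (_≡_)
import Relation.Binary.Reasoning.Setoid as SetoidReasoning

module EuclidProperties (R : RealField) where
  open RealField R
  open IsCommutativeRing isCommutativeRing hiding (zero)
  open Euclid R

  commutativeRing : CommutativeRing _ _
  commutativeRing = record { isCommutativeRing = isCommutativeRing }

  open CommutativeRing commutativeRing using (semiring; *-commutativeSemigroup)
  open import Algebra.Properties.Semiring.Sum semiring
    using (sum; sum-cong-≋; sum-cong-≗; sum-replicate-zero; *-distribˡ-sum; *-distribʳ-sum)
    renaming (∑-comm to sum-comm)
  open import Algebra.Properties.CommutativeSemigroup *-commutativeSemigroup
    using () renaming (x∙yz≈y∙xz to x*yz≈y*xz)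
  open SetoidReasoning setoid

  ∑≡sum : ∀ {n} (f : Fin n → Carrier) → ∑ f ≡ sum f
  ∑≡sum {zero}  f = ≡.refl
  ∑≡sum {suc n} f = ≡.cong (f zero +_) (∑≡sum (λ i → f (suc i)))

  ∑∑≡sum∑ : ∀ {m n} (f : Fin m → Fin n → Carrier) →
            ∑ (λ i → ∑ (f i)) ≡ sum (λ i → sum (f i))
  ∑∑≡sum∑ f = ≡.trans (∑≡sum (λ i → ∑ (f i))) (sum-cong-≗ (λ i → ∑≡sum (f i)))

  ∑-cong : ∀ {n} {f g : Fin n → Carrier} → (∀ i → f i ≈ g i) → ∑ f ≈ ∑ g
  ∑-cong {f = f} {g} f≈g rewrite ∑≡sum f | ∑≡sum g = sum-cong-≋ f≈g

  ∑-zero : ∀ n → ∑ {n} (λ _ → 0#) ≈ 0#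
  ∑-zero n rewrite ∑≡sum {n} (λ _ → 0#) = sum-replicate-zero n

  *-distribˡ-∑ : ∀ {n} c (f : Fin n → Carrier) → c * ∑ f ≈ ∑ (λ i → c * f i)
  *-distribˡ-∑ c f rewrite ∑≡sum f | ∑≡sum (λ i → c * f i) = *-distribˡ-sum c f

  *-distribʳ-∑ : ∀ {n} c (f : Fin n → Carrier) → ∑ f * c ≈ ∑ (λ i → f i * c)
  *-distribʳ-∑ c f rewrite ∑≡sum f | ∑≡sum (λ i → f i * c) = *-distribʳ-sum c f

  ∑-comm : ∀ {m n} (f : Fin m → Fin n → Carrier) →
           ∑ (λ i → ∑ (λ j → f i j)) ≈ ∑ (λ j → ∑ (λ i → f i j))
  ∑-comm f rewrite ∑∑≡sum∑ f | ∑∑≡sum∑ (λ j i → f i j) = sum-comm f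

  ∑-δ : ∀ {n} (j : Fin n) (g : Fin n → Carrier) → ∑ (λ i → δ i j * g i) ≈ g j
  ∑-δ {suc n} zero g =
    trans (+-cong (*-identityˡ (g zero)) (trans (∑-cong {n} (λ i → zeroˡ (g (suc i)))) (∑-zero n)))
          (+-identityʳ (g zero))
  ∑-δ {suc n} (suc j) g = trans (+-cong (zeroˡ _) (∑-δ j (λ i → g (suc i)))) (+-identityˡ _)

  ·-congʳ : ∀ {n} {u u′ w : Vec n} → u ≈ᵥ u′ → u · w ≈ u′ · w
  ·-congʳ u≈u′ = ∑-cong (λ a → *-cong (u≈u′ a) refl)

  •-·-assoc : ∀ {n} c (u w : Vec n) → (c • u) · w ≈ c * (u · w)
  •-·-assoc {n} c u w =
    trans (∑-cong {n} (λ a → *-assoc c (u a) (w a))) (sym (*-distribˡ-∑ c (λ a → u a * w a)))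

  ∑ᵥ-·-distrib : ∀ {m n} (c : Fin m → Carrier) (v : Fin m → Vec n) (w : Vec n) →
                 ∑ᵥ (λ i → c i • v i) · w ≈ ∑ (λ i → c i * (v i · w))
  ∑ᵥ-·-distrib {m} {n} c v w = begin
    ∑ (λ a → ∑ (λ i → c i * v i a) * w a)    ≈⟨ ∑-cong {n} (λ a → *-distribʳ-∑ (w a) (λ i → c i * v i a)) ⟩
    ∑ (λ a → ∑ (λ i → (c i * v i a) * w a))  ≈⟨ ∑-comm (λ a i → (c i * v i a) * w a) ⟩
    ∑ (λ i → ∑ (λ a → (c i * v i a) * w a))  ≈⟨ ∑-cong {m} (λ i → ∑-cong {n} (λ a → *-assoc (c i) (v i a) (w a))) ⟩
    ∑ (λ i → ∑ (λ a → c i * (v i a * w a)))  ≈⟨ ∑-cong {m} (λ i → *-distribˡ-∑ (c i) (λ a → v i a * w a)) ⟨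
    ∑ (λ i → c i * (v i · w))                ∎

  ∑ᵥ-•-∑ᵥ : ∀ {m l n} (c : Fin l → Carrier) (d : Fin m → Fin l → Carrier) (v : Fin m → Vec n) →
            ∑ᵥ (λ j → c j • ∑ᵥ (λ i → d i j • v i)) ≈ᵥ ∑ᵥ (λ i → ∑ (λ j → c j * d i j) • v i)
  ∑ᵥ-•-∑ᵥ {m} {l} c d v a = begin
    ∑ (λ j → c j * ∑ (λ i → d i j * v i a))    ≈⟨ ∑-cong {l} (λ j → *-distribˡ-∑ (c j) (λ i → d i j * v i a)) ⟩
    ∑ (λ j → ∑ (λ i → c j * (d i j * v i a)))  ≈⟨ ∑-comm (λ j i → c j * (d i j * v i a)) ⟩
    ∑ (λ i → ∑ (λ j → c j * (d i j * v i a)))  ≈⟨ ∑-cong {m} (λ i → ∑-cong {l} (λ j → *-assoc (c j) (d i j) (v i a))) ⟨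
    ∑ (λ i → ∑ (λ j → (c j * d i j) * v i a))  ≈⟨ ∑-cong {m} (λ i → *-distribʳ-∑ (v i a) (λ j → c j * d i j)) ⟨
    ∑ (λ i → ∑ (λ j → c j * d i j) * v i a)    ∎

  projSum : ∀ {m n} → (Fin m → Carrier) → (Fin m → Vec n) → Vec n → Vec n
  projSum μ f y = ∑ᵥ (λ i → μ i • p (f i) y)

  projSum-coeffs : ∀ {m n} (μ : Fin m → Carrier) (f : Fin m → Vec n) (y : Vec n) →
                   projSum μ f y ≈ᵥ ∑ᵥ (λ i → (μ i * (f i · y)) • f i)
  projSum-coeffs {m} μ f y a = ∑-cong {m} (λ i → sym (*-assoc (μ i) (f i · y) (f i a)))

  module DualBasis {n} {e e* : Fin n → Vec n} (e*-dual : IsDualBasis e e*) where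

    ∑ᵥ-·-dual : ∀ (c : Fin n → Carrier) k → ∑ᵥ (λ i → c i • e i) · e* k ≈ c k
    ∑ᵥ-·-dual c k = begin
      ∑ᵥ (λ i → c i • e i) · e* k  ≈⟨ ∑ᵥ-·-distrib c e (e* k) ⟩
      ∑ (λ i → c i * (e i · e* k))  ≈⟨ ∑-cong (λ i → trans (*-cong refl (e*-dual i k)) (*-comm _ _)) ⟩
      ∑ (λ i → δ i k * c i)         ≈⟨ ∑-δ k c ⟩
      c k                           ∎

    projSum-on-dual : ∀ (μ : Fin n → Carrier) j → projSum μ e (e* j) ≈ᵥ μ j • e j
    projSum-on-dual μ j a = begin
      ∑ (λ i → μ i * ((e i · e* j) * e i a))  ≈⟨ ∑-cong (λ i → *-cong refl (*-cong (e*-dual i j) refl)) ⟩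
      ∑ (λ i → μ i * (δ i j * e i a))         ≈⟨ ∑-cong (λ i → x*yz≈y*xz (μ i) (δ i j) (e i a)) ⟩
      ∑ (λ i → δ i j * (μ i * e i a))         ≈⟨ ∑-δ j _ ⟩
      μ j * e j a                             ∎

    module _ (e-spans : Spans e) where

      expand : ∀ u → u ≈ᵥ ∑ᵥ (λ i → (u · e* i) • e i)
      expand u a = trans (proj₂ (e-spans u) a) (∑-cong (λ i → *-cong (sym (coord i)) refl))
        where
        coord : ∀ i → u · e* i ≈ proj₁ (e-spans u) i
        coord i = trans (·-congʳ (proj₂ (e-spans u))) (∑ᵥ-·-dual (proj₁ (e-spans u)) i)

      ≈ᵥ⇔·-dual : ∀ {u v} → u ≈ᵥ v ⇔ (∀ k → u · e* k ≈ v · e* k)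
      ≈ᵥ⇔·-dual {u} {v} = mk⇔ (λ u≈v k → ·-congʳ u≈v) λ u·e*≈v·e* a →
        trans (expand u a) (trans (∑-cong (λ i → *-cong (u·e*≈v·e* i) refl)) (sym (expand v a)))

      ·-expand : ∀ (w y : Vec n) → w · y ≈ ∑ (λ j → (e j · y) * (w · e* j))
      ·-expand w y = begin
        w · y                              ≈⟨ ·-congʳ (expand w) ⟩
        ∑ᵥ (λ j → (w · e* j) • e j) · y    ≈⟨ ∑ᵥ-·-distrib _ e y ⟩
        ∑ (λ j → (w · e* j) * (e j · y))   ≈⟨ ∑-cong (λ j → *-comm (w · e* j) (e j · y)) ⟩
        ∑ (λ j → (e j · y) * (w · e* j))   ∎

      projSum-expand : ∀ {m} (μ : Fin m → Carrier) (f : Fin m → Vec n) y →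
                       projSum μ f y ≈ᵥ ∑ᵥ (λ j → (e j · y) • projSum μ f (e* j))
      projSum-expand μ f y a = begin
        projSum μ f y a                                                    ≈⟨ projSum-coeffs μ f y a ⟩
        ∑ᵥ (λ i → (μ i * (f i · y)) • f i) a                               ≈⟨ ∑-cong (λ i → *-cong (coeff i) refl) ⟩
        ∑ᵥ (λ i → ∑ (λ j → (e j · y) * (μ i * (f i · e* j))) • f i) a      ≈⟨ ∑ᵥ-•-∑ᵥ (λ j → e j · y) _ f a ⟨
        ∑ᵥ (λ j → (e j · y) • ∑ᵥ (λ i → (μ i * (f i · e* j)) • f i)) a    ≈⟨ ∑-cong (λ j → *-cong refl (projSum-coeffs μ f (e* j) a)) ⟨
        ∑ᵥ (λ j → (e j · y) • projSum μ f (e* j)) a                        ∎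
        where
        coeff : ∀ i → μ i * (f i · y) ≈ ∑ (λ j → (e j · y) * (μ i * (f i · e* j)))
        coeff i = trans (*-cong refl (·-expand (f i) y))
          (trans (*-distribˡ-∑ (μ i) (λ j → (e j · y) * (f i · e* j)))
                 (∑-cong (λ j → x*yz≈y*xz (μ i) (e j · y) (f i · e* j))))

      projSum-≈-from-dual : ∀ {m m′} (μ : Fin m → Carrier) (f : Fin m → Vec n)
                            (μ′ : Fin m′ → Carrier) (f′ : Fin m′ → Vec n) →
                            (∀ j → projSum μ f (e* j) ≈ᵥ projSum μ′ f′ (e* j)) →
                            ∀ y → projSum μ f y ≈ᵥ projSum μ′ f′ y
      projSum-≈-from-dual μ f μ′ f′ agree y a = trans (projSum-expand μ f y a)
        (trans (∑-cong (λ j → *-cong refl (agree j a))) (sym (projSum-expand μ′ f′ y a)))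

  module _ {n : ℕ} (e e′ e* e′* : Fin n → Vec n) (λ₁ λ′ : Fin n → Carrier) where

    Cond1-swap : Cond1 e e′ e* e′* λ₁ λ′ ⇔ Cond1 e′ e e′* e* λ′ λ₁
    Cond1-swap = mk⇔ (λ c1 y a → sym (c1 y a)) (λ c1 y a → sym (c1 y a))

    Cond1⇔Cond2 : Spans e → IsDualBasis e e* →
                  Cond1 e e′ e* e′* λ₁ λ′ ⇔ Cond2 e e′ e* e′* λ₁ λ′
    Cond1⇔Cond2 e-spans e*-dual = mk⇔
      (λ c1 j a → trans (sym (projSum-on-dual λ₁ j a)) (trans (c1 (e* j) a) (projSum-coeffs λ′ e′ (e* j) a)))
      (λ c2 → projSum-≈-from-dual e-spans λ₁ e λ′ e′ λ j a →
        trans (projSum-on-dual λ₁ j a) (trans (c2 j a) (sym (projSum-coeffs λ′ e′ (e* j) a))))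
      where open DualBasis e*-dual

    Cond2⇔Cond4 : Spans e′ → IsDualBasis e′ e′* →
                  Cond2 e e′ e* e′* λ₁ λ′ ⇔ Cond4 e e′ e* e′* λ₁ λ′
    Cond2⇔Cond4 e′-spans e′*-dual = mk⇔
      (λ c2 j k → trans (sym (•-·-assoc (λ₁ j) (e j) (e′* k)))
        (trans (Equivalence.to (≈ᵥ⇔·-dual e′-spans) (c2 j) k) (∑ᵥ-·-dual _ k)))
      (λ c4 j → Equivalence.from (≈ᵥ⇔·-dual e′-spans) λ k →
        trans (•-·-assoc (λ₁ j) (e j) (e′* k)) (trans (c4 j k) (sym (∑ᵥ-·-dual _ k))))
      where open DualBasis e′*-dual

lemma2p5 : (R : RealField) (n : ℕ)
    (e e′ e* e′* : Fin n → Euclid.Vec R n) (λ₁ λ′ : Fin n → RealField.Carrier R) →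
    Euclid.IsBasis R e → Euclid.IsBasis R e′ →
    (∀ i → Euclid.IsUnit R (e i)) → (∀ i → Euclid.IsUnit R (e′ i)) →
    Euclid.IsDualBasis R e e* → Euclid.IsDualBasis R e′ e′* →
    (Euclid.Cond1 R e e′ e* e′* λ₁ λ′ ⇔ Euclid.Cond2 R e e′ e* e′* λ₁ λ′) ×
    (Euclid.Cond1 R e e′ e* e′* λ₁ λ′ ⇔ Euclid.Cond3 R e e′ e* e′* λ₁ λ′) ×
    (Euclid.Cond1 R e e′ e* e′* λ₁ λ′ ⇔ Euclid.Cond4 R e e′ e* e′* λ₁ λ′)
lemma2p5 R n e e′ e* e′* λ₁ λ′ (_ , e-spans) (_ , e′-spans) _ _ e*-dual e′*-dual =
  Cond1⇔Cond2 e e′ e* e′* λ₁ λ′ e-spans e*-dual ,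
  Cond1⇔Cond2 e′ e e′* e* λ′ λ₁ e′-spans e′*-dual ⇔-∘ Cond1-swap e e′ e* e′* λ₁ λ′ ,
  Cond2⇔Cond4 e e′ e* e′* λ₁ λ′ e′-spans e′*-dual ⇔-∘ Cond1⇔Cond2 e e′ e* e′* λ₁ λ′ e-spans e*-dual
  where open EuclidProperties R
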